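{- Let $r \geq 2$, $2 \le h \le r$, and let $k$ be a positive integer with $k \ne 2$. Let $G$ be a finite simple $r$-regular graph. If $G$ has an $h$-factor (an $h$-regular spanning subgraph) that is completely $k$-magic, then $G$ is completely $k$-magic.
   Context: $\mathbb{Z}_1=\mathbb{Z}$ (the integers) and for $k\ge 2$, $\mathbb{Z}_k$ is the integers modulo $k$. For $c \in \mathbb{Z}_k$, a graph $G$ is $c$-sum $k$-magic if there is an edge labeling $\ell: E(G) \to \mathbb{Z}_k\setminus\{0\}$ such that for every vertex $v$, $\sum_{u \in N(v)} \ell(uv) = c$ in $\mathbb{Z}_k$, where $N(v)$ is the neighborhood of $v$. $G$ is completely $k$-magic if it is $c$-sum $k$-magic for every $c \in \mathbb{Z}_k$. -}

module Defs where

open import Data.Nat using (ℕ; zero; suc)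
import Data.Nat as ℕ
open import Data.Integer using (ℤ; +_; _-_)
import Data.Integer as ℤ
open import Data.Integer.Divisibility using (_∣_)
open import Data.Fin using (Fin; zero; suc)
open import Data.Bool using (Bool; true; false; if_then_else_)
open import Data.Product using (Σ; _×_)
open import Relation.Binary.PropositionalEquality using (_≡_)
open import Relation.Nullary using (¬_)

record Graph (n : ℕ) : Set where
  field
    adj    : Fin n → Fin n → Bool
    sym    : ∀ i j → adj i j ≡ adj j i
    irrefl : ∀ i → adj i i ≡ false
open Graph public

sumℕ : (n : ℕ) → (Fin n → ℕ) → ℕ
sumℕ zero    f = 0
sumℕ (suc n) f = f zero ℕ.+ sumℕ n (λ i → f (suc i))

sumℤ : (n : ℕ) → (Fin n → ℤ) → ℤ
sumℤ zero    f = + 0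
sumℤ (suc n) f = f zero ℤ.+ sumℤ n (λ i → f (suc i))

degree : ∀ {n} → Graph n → Fin n → ℕ
degree {n} G v = sumℕ n (λ u → if adj G v u then 1 else 0)

Regular : ∀ {n} → ℕ → Graph n → Set
Regular r G = ∀ v → degree G v ≡ r

SpanningSubgraph : ∀ {n} → Graph n → Graph n → Set
SpanningSubgraph {n} H G = ∀ (i j : Fin n) → adj H i j ≡ true → adj G i j ≡ true

-- Equality in ℤ_k, elements represented by integers:
-- ℤ_1 = ℤ (plain equality); for k ≥ 2, congruence modulo k.
ZkEq : ℕ → ℤ → ℤ → Set
ZkEq (suc zero) a b = a ≡ b
ZkEq k          a b = (+ k) ∣ (a - b)

vertexSum : ∀ {n} → Graph n → (Fin n → Fin n → ℤ) → Fin n → ℤ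
vertexSum {n} G ℓ v = sumℤ n (λ u → if adj G v u then ℓ v u else + 0)

CSumMagic : ∀ {n} → ℕ → ℤ → Graph n → Set
CSumMagic {n} k c G =
  Σ (Fin n → Fin n → ℤ) λ ℓ →
      (∀ i j → adj G i j ≡ true → ℓ i j ≡ ℓ j i)
    × (∀ i j → adj G i j ≡ true → ¬ ZkEq k (ℓ i j) (+ 0))
    × (∀ v → ZkEq k (vertexSum G ℓ v) c)

CompletelyMagic : ∀ {n} → ℕ → Graph n → Set
CompletelyMagic k G = ∀ (c : ℤ) → CSumMagic k c G

-- Label the edges of G lying in the h-factor H by a (c − (r − h))-sum labelling
-- of H, and every other edge by 1. Each vertex then meets exactly r − h edges
-- outside H, so its sum becomes (c − (r − h)) + (r − h) = c; since 1 ≠ 0 in every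
-- ℤ_k, the labelling is still nowhere zero.
module Submission where

open import Defs
open import Data.Nat using (ℕ; _≤_; zero; suc)
import Data.Nat.Divisibility as ℕ
open import Data.Integer using (ℤ; +_; _-_; _+_)
open import Data.Integer.Divisibility using (_∣_)
open import Data.Integer.Tactic.RingSolver using (solve-∀)
open import Data.Fin using (Fin)
open import Data.Bool using (true; false; if_then_else_)
open import Data.Product using (_,_)
open import Function using (_∘_)
open import Relation.Binary.PropositionalEquality
  using (_≡_; _≢_; refl; cong; cong₂; subst; subst₂; trans; module ≡-Reasoning)
  renaming (sym to ≡-sym)
open import Relation.Nullary using (¬_)

sumℤ-cong : ∀ n {f g : Fin n → ℤ} → (∀ u → f u ≡ g u) → sumℤ n f ≡ sumℤ n g
sumℤ-cong zero    f≡g = refl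
sumℤ-cong (suc n) f≡g = cong₂ _+_ (f≡g Fin.zero) (sumℤ-cong n (f≡g ∘ Fin.suc))

sumℤ-+ : ∀ n (f g : Fin n → ℤ) → sumℤ n (λ u → f u + g u) ≡ sumℤ n f + sumℤ n g
sumℤ-+ zero    f g = refl
sumℤ-+ (suc n) f g =
  trans (cong (_+_ (f Fin.zero + g Fin.zero)) (sumℤ-+ n (f ∘ Fin.suc) (g ∘ Fin.suc)))
        (interchange (f Fin.zero) (g Fin.zero) _ _)
  where
  interchange : ∀ a b c d → (a + b) + (c + d) ≡ (a + c) + (b + d)
  interchange = solve-∀

sumℤ-ℕ : ∀ n (f : Fin n → ℕ) → sumℤ n (+_ ∘ f) ≡ + sumℕ n f
sumℤ-ℕ zero    f = refl
sumℤ-ℕ (suc n) f = cong (_+_ (+ f Fin.zero)) (sumℤ-ℕ n (f ∘ Fin.suc))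

degreeℤ : ∀ {n} (G : Graph n) v →
  sumℤ n (λ u → + (if adj G v u then 1 else 0)) ≡ + degree G v
degreeℤ {n} G v = sumℤ-ℕ n (λ u → if adj G v u then 1 else 0)

a+x≡b+y⇒b+[y-x]≡a : ∀ a b x y → a + x ≡ b + y → b + (y - x) ≡ a
a+x≡b+y⇒b+[y-x]≡a a b x y a+x≡b+y = begin
    b + (y - x)    ≡⟨ rearrange b x y ⟩
    (b + y) - x    ≡⟨ cong (_- x) (≡-sym a+x≡b+y) ⟩
    (a + x) - x    ≡⟨ cancel a x ⟩
    a              ∎
  where
  open ≡-Reasoning
  rearrange : ∀ b x y → b + (y - x) ≡ (b + y) - x
  rearrange = solve-∀
  cancel : ∀ a x → (a + x) - x ≡ a
  cancel = solve-∀

c-d+d≡c : ∀ c d → c - d + d ≡ c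
c-d+d≡c = solve-∀

∣-diff-+ : ∀ {m} x y d → m ∣ x - y → m ∣ (x + d) - (y + d)
∣-diff-+ {m} x y d = subst (m ∣_) (cancel x y d)
  where
  cancel : ∀ x y d → x - y ≡ (x + d) - (y + d)
  cancel = solve-∀

ZkEq-+ʳ : ∀ k {x y} d → ZkEq k x y → ZkEq k (x + d) (y + d)
ZkEq-+ʳ zero                {x} {y} d = ∣-diff-+ {+ 0} x y d
ZkEq-+ʳ (suc zero)                  d = cong (_+ d)
ZkEq-+ʳ (suc (suc m))       {x} {y} d = ∣-diff-+ {+ suc (suc m)} x y d

1≢0-ZkEq : ∀ k → ¬ ZkEq k (+ 1) (+ 0)
1≢0-ZkEq zero          0∣1 with ℕ.∣1⇒≡1 0∣1
... | ()
1≢0-ZkEq (suc zero)    ()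
1≢0-ZkEq (suc (suc m)) k∣1 with ℕ.∣1⇒≡1 k∣1
... | ()

module _ {n} (H : Graph n) (ℓ : Fin n → Fin n → ℤ) where

  extendBy1 : Fin n → Fin n → ℤ
  extendBy1 i j = if adj H i j then ℓ i j else + 1

  extendBy1-sym : (∀ i j → adj H i j ≡ true → ℓ i j ≡ ℓ j i) →
                  ∀ i j → extendBy1 i j ≡ extendBy1 j i
  extendBy1-sym ℓ-sym i j rewrite Graph.sym H j i with adj H i j in ij
  ... | true  = ℓ-sym i j ij
  ... | false = refl

  extendBy1-nonzero : ∀ k →
                      (∀ i j → adj H i j ≡ true → ¬ ZkEq k (ℓ i j) (+ 0)) →
                      ∀ i j → ¬ ZkEq k (extendBy1 i j) (+ 0)
  extendBy1-nonzero k ℓ≢0 i j with adj H i j in ij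
  ... | true  = ℓ≢0 i j ij
  ... | false = 1≢0-ZkEq k

  -- Both sides count every G-edge at v once with its H-label or with 1.
  vertexSum-extendBy1 : ∀ {G} → SpanningSubgraph H G → ∀ v →
    vertexSum G extendBy1 v + + degree H v ≡ vertexSum H ℓ v + + degree G v
  vertexSum-extendBy1 {G} H⊆G v = begin
      vertexSum G extendBy1 v + + degree H v
    ≡⟨ cong (_+_ (vertexSum G extendBy1 v)) (≡-sym (degreeℤ H v)) ⟩
      vertexSum G extendBy1 v + sumℤ n (λ u → + indicator H u)
    ≡⟨ ≡-sym (sumℤ-+ n _ _) ⟩
      sumℤ n (λ u → term G extendBy1 u + + indicator H u)
    ≡⟨ sumℤ-cong n pointwise ⟩
      sumℤ n (λ u → term H ℓ u + + indicator G u)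
    ≡⟨ sumℤ-+ n _ _ ⟩
      vertexSum H ℓ v + sumℤ n (λ u → + indicator G u)
    ≡⟨ cong (_+_ (vertexSum H ℓ v)) (degreeℤ G v) ⟩
      vertexSum H ℓ v + + degree G v
    ∎
    where
    open ≡-Reasoning
    indicator : Graph n → Fin n → ℕ
    indicator K u = if adj K v u then 1 else 0
    term : Graph n → (Fin n → Fin n → ℤ) → Fin n → ℤ
    term K m u = if adj K v u then m v u else + 0
    pointwise : ∀ u → term G extendBy1 u + + indicator H u ≡ term H ℓ u + + indicator G u
    pointwise u with adj H v u in vu∈H | adj G v u in vu∈G
    ... | true  | true  = refl
    ... | false | true  = refl
    ... | false | false = refl
    ... | true  | false with trans (≡-sym (H⊆G v u vu∈H)) vu∈G
    ...   | ()

CSumMagic-fromFactor : ∀ {n} r h k c →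
  (G : Graph n) → Regular r G → (H : Graph n) → SpanningSubgraph H G → Regular h H →
  CSumMagic k (c - (+ r - + h)) H → CSumMagic k c G
CSumMagic-fromFactor r h k c G regG H H⊆G regH (ℓ , ℓ-sym , ℓ≢0 , ℓ-sum) =
  extendBy1 H ℓ ,
  (λ i j _ → extendBy1-sym H ℓ ℓ-sym i j) ,
  (λ i j _ → extendBy1-nonzero H ℓ k ℓ≢0 i j) ,
  λ v → subst₂ (ZkEq k) (vertexSum-shift v) (c-d+d≡c c d) (ZkEq-+ʳ k d (ℓ-sum v))
  where
  d : ℤ
  d = + r - + h
  vertexSum-shift : ∀ v → vertexSum H ℓ v + d ≡ vertexSum G (extendBy1 H ℓ) v
  vertexSum-shift v =
    a+x≡b+y⇒b+[y-x]≡a (vertexSum G (extendBy1 H ℓ) v) (vertexSum H ℓ v) (+ h) (+ r)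
    (subst₂ (λ x y → vertexSum G (extendBy1 H ℓ) v + + x ≡ vertexSum H ℓ v + + y)
            (regH v) (regG v) (vertexSum-extendBy1 H ℓ {G} H⊆G v))

mainTheorem2 : (r h k n : ℕ) → 2 ≤ r → 2 ≤ h → h ≤ r → 1 ≤ k → k ≢ 2 →
    (G : Graph n) → Regular r G →
    (H : Graph n) → SpanningSubgraph H G → Regular h H →
    CompletelyMagic k H → CompletelyMagic k G
mainTheorem2 r h k n _ _ _ _ _ G regG H H⊆G regH magicH c =
  CSumMagic-fromFactor r h k c G regG H H⊆G regH (magicH (c - (+ r - + h)))
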